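{- Assume the following Conjecture holds: for every positive integer $n$ and every system $T\subseteq\{x_i+1=x_k,\ x_i\cdot x_j=x_k:\ i,j,k\in\{1,\ldots,n\}\}$ which has only finitely many solutions in positive integers $x_1,\ldots,x_n$, each such solution satisfies $x_1,\ldots,x_n\leqslant f(n)$. Then there is an algorithm which, given any polynomial $D(x_1,\ldots,x_p)$ with integer coefficients such that the equation $D(x_1,\ldots,x_p)=0$ has only finitely many integer solutions, computes an integer that bounds from above the absolute values of all entries of all these solutions.
   Context: Define $f:\mathbb{N}\setminus\{0\}\to\mathbb{N}\setminus\{0\}$ by $f(1)=1$, $f(n)=2^{2^{n-2}}$ for $n\in\{2,3,4,5\}$, and $f(n)=\left(2+2^{2^{n-4}}\right)^{2^{n-4}}$ for $n\geqslant 6$. -}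

module Defs where

open import Data.Nat as ℕ using (ℕ; zero; suc; _≤_)
open import Data.Integer as ℤ using (ℤ; ∣_∣)
open import Data.Fin using (Fin)
open import Data.Vec using (Vec; lookup; []) renaming (_∷_ to _∷ᵥ_)
open import Data.List using (List; []; _∷_)
open import Data.List.Membership.Propositional using (_∈_)
open import Data.List.Relation.Unary.All using (All)
open import Data.Product using (_×_; Σ; ∃; ∃-syntax; _,_)
open import Relation.Binary.PropositionalEquality using (_≡_)

-- The function f (only the values at positive n matter; f 0 is unused).

f : ℕ → ℕ
f 0 = 1
f 1 = 1
f 2 = 2 ℕ.^ (2 ℕ.^ 0)
f 3 = 2 ℕ.^ (2 ℕ.^ 1)
f 4 = 2 ℕ.^ (2 ℕ.^ 2)
f 5 = 2 ℕ.^ (2 ℕ.^ 3)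
f n@(suc (suc (suc (suc (suc (suc _)))))) =
  (2 ℕ.+ 2 ℕ.^ (2 ℕ.^ (n ℕ.∸ 4))) ℕ.^ (2 ℕ.^ (n ℕ.∸ 4))

data Eqn (n : ℕ) : Set where
  addOne : Fin n → Fin n → Eqn n
  mul    : Fin n → Fin n → Fin n → Eqn n

System : ℕ → Set
System n = List (Eqn n)

SatisfiesEqn : ∀ {n} → Vec ℕ n → Eqn n → Set
SatisfiesEqn x (addOne i k) = lookup x i ℕ.+ 1 ≡ lookup x k
SatisfiesEqn x (mul i j k)  = lookup x i ℕ.* lookup x j ≡ lookup x k

Positive : ∀ {n} → Vec ℕ n → Set
Positive {n} x = (i : Fin n) → 1 ≤ lookup x i

PosSolution : ∀ {n} → System n → Vec ℕ n → Set
PosSolution T x = Positive x × All (SatisfiesEqn x) T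

FinitelyManyPosSolutions : ∀ {n} → System n → Set
FinitelyManyPosSolutions {n} T =
  ∃[ xs ] ((x : Vec ℕ n) → PosSolution T x → x ∈ xs)

Conjecture : Set
Conjecture =
  (n : ℕ) → 1 ≤ n → (T : System n) → FinitelyManyPosSolutions T →
  (x : Vec ℕ n) → PosSolution T x → (i : Fin n) → lookup x i ≤ f n

-- Polynomials with integer coefficients in p variables, given as a
-- finite sum of monomials  c · x_1^{e_1} ⋯ x_p^{e_p}.

Monomial : ℕ → Set
Monomial p = ℤ × Vec ℕ p

Poly : ℕ → Set
Poly p = List (Monomial p)

monomialValue : ∀ {p} → Vec ℤ p → Vec ℕ p → ℤ
monomialValue [] [] = ℤ.+ 1
monomialValue (xi ∷ᵥ xs) (e ∷ᵥ es) = (xi ℤ.^ e) ℤ.* monomialValue xs es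

evalMon : ∀ {p} → Vec ℤ p → Monomial p → ℤ
evalMon x (c , es) = c ℤ.* monomialValue x es

eval : ∀ {p} → Poly p → Vec ℤ p → ℤ
eval [] x = ℤ.+ 0
eval (m ∷ ms) x = evalMon x m ℤ.+ eval ms x

IntSolution : ∀ {p} → Poly p → Vec ℤ p → Set
IntSolution D x = eval D x ≡ ℤ.+ 0

FinitelyManyIntSolutions : ∀ {p} → Poly p → Set
FinitelyManyIntSolutions {p} D =
  ∃[ xs ] ((x : Vec ℤ p) → IntSolution D x → x ∈ xs)

module Submission where

-- Fix the signs of an integer solution x of D = 0 and encode it by the positive vector
-- y = (∣ x i ∣ + 1)ᵢ. Splitting coefficients by sign, D(x) = P(y) − Q(y) where P and Q are
-- built from 1, the y i, successor, product and sum. Introducing one unknown per node turns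
-- P(y) = Q(y) into a system of equations u + 1 = v and u · v = w whose positive solutions are
-- exactly the canonical extensions of the y with P(y) = Q(y); sums are expressed through
-- z = a + b ⟺ (z a + 1)(z b + 1) = z² (a b + 1) + 1 for z ≥ 1. Solutions of a system
-- determine solutions of D = 0, so each system has finitely many solutions when D = 0 has, and
-- its number N of unknowns depends only on D; the Conjecture then gives ∣ x i ∣ + 1 ≤ f N.

open import Defs

module Reduction where

  open import Data.Bool using (Bool; true; false; if_then_else_)
  open import Data.Fin using (Fin; zero; suc; _↑ˡ_; _↑ʳ_; splitAt)
  open import Data.Fin.Patterns using (0F; 1F; 2F; 3F; 4F; 5F; 6F; 7F; 8F; 9F)
  open import Data.Fin.Properties using (splitAt⁻¹-↑ˡ; splitAt⁻¹-↑ʳ)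
  open import Data.Integer as ℤ using (ℤ; +_; -[1+_]; ∣_∣; 0ℤ)
  import Data.Integer.Properties as ℤ
  import Data.Integer.Tactic.RingSolver as ℤ-Solver
  open import Data.List as List using ([]; _∷_; _++_)
  open import Data.List.Membership.Propositional using (_∈_)
  open import Data.List.Membership.Propositional.Properties using (∈-map⁺)
  open import Data.List.Relation.Unary.All using (All; []; _∷_)
  open import Data.List.Relation.Unary.All.Properties using (++⁺; ++⁻ˡ; ++⁻ʳ)
  open import Data.Nat using (ℕ; zero; suc; _+_; _*_; _≤_; s≤s; z≤n)
  open import Data.Nat.Properties
  open import Data.Nat.Tactic.RingSolver using (solve-∀)
  open import Data.Product using (_×_; _,_; proj₁; proj₂)
  open import Data.Sum using (inj₁; inj₂)
  open import Data.Vec using (Vec; []; _∷_; lookup; tabulate; map)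
  open import Data.Vec.Properties using (lookup∘tabulate; tabulate∘lookup; tabulate-cong; tabulate-∘; lookup-map)
  open import Data.Vec.Functional as Vector using (Vector)
  open import Data.Vec.Functional.Properties using (lookup-++ˡ; lookup-++ʳ)
  import Data.Vec.Functional.Relation.Unary.All as Vector
  import Data.Vec.Functional.Relation.Unary.All.Properties as Vector
  open import Function using (_∘_)
  open import Relation.Binary.PropositionalEquality

  module _ {A : Set} {m n : ℕ} {h : Vector A (m + n)} {xs : Vector A m} {ys : Vector A n} where

    ≗-++⁺ : h ∘ (_↑ˡ n) ≗ xs → h ∘ (m ↑ʳ_) ≗ ys → h ≗ xs Vector.++ ys
    ≗-++⁺ hˡ hʳ k with splitAt m k in eq
    ... | inj₁ i = trans (cong h (sym (splitAt⁻¹-↑ˡ eq))) (hˡ i)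
    ... | inj₂ j = trans (cong h (sym (splitAt⁻¹-↑ʳ eq))) (hʳ j)

    ≗-++⁻ˡ : h ≗ xs Vector.++ ys → h ∘ (_↑ˡ n) ≗ xs
    ≗-++⁻ˡ h≗ i = trans (h≗ (i ↑ˡ n)) (lookup-++ˡ xs ys i)

    ≗-++⁻ʳ : h ≗ xs Vector.++ ys → h ∘ (m ↑ʳ_) ≗ ys
    ≗-++⁻ʳ h≗ j = trans (h≗ (m ↑ʳ j)) (lookup-++ʳ xs ys j)

  leftOf : ∀ k {m n} {A : Set} → (Fin (k + (m + n)) → A) → Fin m → A
  leftOf k {n = n} σ = σ ∘ (k ↑ʳ_) ∘ (_↑ˡ n)

  rightOf : ∀ k {m n} {A : Set} → (Fin (k + (m + n)) → A) → Fin n → A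
  rightOf k {m} σ = σ ∘ (k ↑ʳ_) ∘ (m ↑ʳ_)

  mul-holds : ∀ {u v w a b} → u ≡ a → v ≡ b → w ≡ a * b → u * v ≡ w
  mul-holds u≡a v≡b w≡ab = trans (cong₂ _*_ u≡a v≡b) (sym w≡ab)

  addOne-holds : ∀ {u w a} → u ≡ a → w ≡ a + 1 → u + 1 ≡ w
  addOne-holds u≡a w≡a+1 = trans (cong (_+ 1) u≡a) (sym w≡a+1)

  isOne : ∀ {M} → Fin M → Eqn M
  isOne k = mul k k k

  n*n≡n⇒n≡1 : ∀ n → 1 ≤ n → n * n ≡ n → n ≡ 1
  n*n≡n⇒n≡1 (suc n) _ eq = *-cancelʳ-≡ (suc n) 1 (suc n) (trans eq (sym (*-identityˡ (suc n))))

  -- Addition through successor and multiplication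

  addition-criterion : ∀ z a b → 1 ≤ z → (z * a + 1) * (z * b + 1) ≡ z * z * (a * b + 1) + 1 → z ≡ a + b
  addition-criterion z@(suc _) a b _ eq =
    sym (*-cancelˡ-≡ (a + b) z z (+-cancelˡ-≡ (z * z * (a * b) + 1) _ _ (begin
      z * z * (a * b) + 1 + z * (a + b)  ≡⟨ expandˡ z a b ⟩
      (z * a + 1) * (z * b + 1)          ≡⟨ eq ⟩
      z * z * (a * b + 1) + 1            ≡⟨ expandʳ z a b ⟩
      z * z * (a * b) + 1 + z * z        ∎)))
    where
    open ≡-Reasoning
    expandˡ : ∀ z a b → z * z * (a * b) + 1 + z * (a + b) ≡ (z * a + 1) * (z * b + 1)
    expandˡ = solve-∀
    expandʳ : ∀ z a b → z * z * (a * b + 1) + 1 ≡ z * z * (a * b) + 1 + z * z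
    expandʳ = solve-∀

  additionTable : ℕ → ℕ → ℕ → Vector ℕ 10
  additionTable z a b 0F = z
  additionTable z a b 1F = z * a
  additionTable z a b 2F = z * a + 1
  additionTable z a b 3F = z * b
  additionTable z a b 4F = z * b + 1
  additionTable z a b 5F = (z * a + 1) * (z * b + 1)
  additionTable z a b 6F = a * b
  additionTable z a b 7F = a * b + 1
  additionTable z a b 8F = z * z
  additionTable z a b 9F = z * z * (a * b + 1)

  addition : ∀ {M} → (Fin 10 → Fin M) → Fin M → Fin M → System M
  addition τ a b =
    mul (τ 0F) a (τ 1F) ∷ addOne (τ 1F) (τ 2F) ∷ mul (τ 0F) b (τ 3F) ∷ addOne (τ 3F) (τ 4F) ∷
    mul (τ 2F) (τ 4F) (τ 5F) ∷ mul a b (τ 6F) ∷ addOne (τ 6F) (τ 7F) ∷ mul (τ 0F) (τ 0F) (τ 8F) ∷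
    mul (τ 8F) (τ 7F) (τ 9F) ∷ addOne (τ 9F) (τ 5F) ∷ []

  additionTable-pos : ∀ {z a b} → 1 ≤ z → 1 ≤ a → 1 ≤ b → Vector.All (1 ≤_) (additionTable z a b)
  additionTable-pos (s≤s _) (s≤s _) (s≤s _) 0F = s≤s z≤n
  additionTable-pos (s≤s _) (s≤s _) (s≤s _) 1F = s≤s z≤n
  additionTable-pos (s≤s _) (s≤s _) (s≤s _) 2F = s≤s z≤n
  additionTable-pos (s≤s _) (s≤s _) (s≤s _) 3F = s≤s z≤n
  additionTable-pos (s≤s _) (s≤s _) (s≤s _) 4F = s≤s z≤n
  additionTable-pos (s≤s _) (s≤s _) (s≤s _) 5F = s≤s z≤n
  additionTable-pos (s≤s _) (s≤s _) (s≤s _) 6F = s≤s z≤n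
  additionTable-pos (s≤s _) (s≤s _) (s≤s _) 7F = s≤s z≤n
  additionTable-pos (s≤s _) (s≤s _) (s≤s _) 8F = s≤s z≤n
  additionTable-pos (s≤s _) (s≤s _) (s≤s _) 9F = s≤s z≤n

  module _ {M : ℕ} {x : Vec ℕ M} (τ : Fin 10 → Fin M) {a b : Fin M} {A B : ℕ} where

    addition-sound : lookup x ∘ τ ≗ additionTable (A + B) A B → lookup x a ≡ A → lookup x b ≡ B →
                     All (SatisfiesEqn x) (addition τ a b)
    addition-sound t xa xb =
      mul-holds (t 0F) xa (t 1F) ∷ addOne-holds (t 1F) (t 2F) ∷ mul-holds (t 0F) xb (t 3F) ∷
      addOne-holds (t 3F) (t 4F) ∷ mul-holds (t 2F) (t 4F) (t 5F) ∷ mul-holds xa xb (t 6F) ∷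
      addOne-holds (t 6F) (t 7F) ∷ mul-holds (t 0F) (t 0F) (t 8F) ∷ mul-holds (t 8F) (t 7F) (t 9F) ∷
      addOne-holds (t 9F) (trans (t 5F) (sym (identity A B))) ∷ []
      where
      identity : ∀ a b → (a + b) * (a + b) * (a * b + 1) + 1 ≡ ((a + b) * a + 1) * ((a + b) * b + 1)
      identity = solve-∀

    addition-complete : 1 ≤ lookup x (τ 0F) → lookup x a ≡ A → lookup x b ≡ B →
                        All (SatisfiesEqn x) (addition τ a b) → lookup x ∘ τ ≗ additionTable (A + B) A B
    addition-complete z≥1 xa xb (q₁ ∷ q₂ ∷ q₃ ∷ q₄ ∷ q₅ ∷ q₆ ∷ q₇ ∷ q₈ ∷ q₉ ∷ q₁₀ ∷ []) k =
      trans (table k) (cong (λ z → additionTable z A B k) z≡A+B)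
      where
      z : ℕ
      z = lookup x (τ 0F)
      x₁ : lookup x (τ 1F) ≡ z * A
      x₁ = trans (sym q₁) (cong (z *_) xa)
      x₂ : lookup x (τ 2F) ≡ z * A + 1
      x₂ = trans (sym q₂) (cong (_+ 1) x₁)
      x₃ : lookup x (τ 3F) ≡ z * B
      x₃ = trans (sym q₃) (cong (z *_) xb)
      x₄ : lookup x (τ 4F) ≡ z * B + 1
      x₄ = trans (sym q₄) (cong (_+ 1) x₃)
      x₅ : lookup x (τ 5F) ≡ (z * A + 1) * (z * B + 1)
      x₅ = trans (sym q₅) (cong₂ _*_ x₂ x₄)
      x₆ : lookup x (τ 6F) ≡ A * B
      x₆ = trans (sym q₆) (cong₂ _*_ xa xb)
      x₇ : lookup x (τ 7F) ≡ A * B + 1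
      x₇ = trans (sym q₇) (cong (_+ 1) x₆)
      x₈ : lookup x (τ 8F) ≡ z * z
      x₈ = sym q₈
      x₉ : lookup x (τ 9F) ≡ z * z * (A * B + 1)
      x₉ = trans (sym q₉) (cong₂ _*_ x₈ x₇)
      table : lookup x ∘ τ ≗ additionTable z A B
      table 0F = refl
      table 1F = x₁
      table 2F = x₂
      table 3F = x₃
      table 4F = x₄
      table 5F = x₅
      table 6F = x₆
      table 7F = x₇
      table 8F = x₈
      table 9F = x₉
      z≡A+B : z ≡ A + B
      z≡A+B = addition-criterion z A B z≥1 (trans (sym x₅) (trans (sym q₁₀) (cong (_+ 1) x₉)))

  -- Expressions over positive unknowns

  data Expr (p : ℕ) : Set where
    one       : Expr p
    var⁺ var⁻ : Fin p → Expr p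
    succ      : Expr p → Expr p
    _⊗_ _⊕_   : Expr p → Expr p → Expr p

  -- A variable always owns one unknown, forced to be 1 and standing for its value when that
  -- value is 1; owning it also when the variable reads y i keeps the number of unknowns
  -- independent of the sign pattern.
  size : ∀ {p} → Expr p → ℕ
  size one      = 1
  size (var⁺ _) = 1
  size (var⁻ _) = 1
  size (succ e) = suc (size e)
  size (e ⊗ f)  = 1 + (size e + size f)
  size (e ⊕ f)  = 10 + (size e + size f)

  -- s i says whether the integer x i is ≥ 0; x i is encoded by the positive y i = ∣ x i ∣ + 1,
  -- so that x i = ⟦ var⁺ i ⟧ y − ⟦ var⁻ i ⟧ y.
  module Semantics {p : ℕ} (s : Fin p → Bool) where

    ⟦_⟧ : Expr p → Vec ℕ p → ℕ
    ⟦ one ⟧    y = 1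
    ⟦ var⁺ i ⟧ y = if s i then lookup y i else 1
    ⟦ var⁻ i ⟧ y = if s i then 1 else lookup y i
    ⟦ succ e ⟧ y = ⟦ e ⟧ y + 1
    ⟦ e ⊗ f ⟧  y = ⟦ e ⟧ y * ⟦ f ⟧ y
    ⟦ e ⊕ f ⟧  y = ⟦ e ⟧ y + ⟦ f ⟧ y

    witness : (e : Expr p) → Vec ℕ p → Vector ℕ (size e)
    witness one      y _ = 1
    witness (var⁺ _) y _ = 1
    witness (var⁻ _) y _ = 1
    witness (succ e) y = (⟦ e ⟧ y + 1) Vector.∷ witness e y
    witness (e ⊗ f)  y = (⟦ e ⟧ y * ⟦ f ⟧ y) Vector.∷ (witness e y Vector.++ witness f y)
    witness (e ⊕ f)  y =
      additionTable (⟦ e ⟧ y + ⟦ f ⟧ y) (⟦ e ⟧ y) (⟦ f ⟧ y) Vector.++ (witness e y Vector.++ witness f y)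

    module _ {M : ℕ} where

      out : (e : Expr p) → (Fin (size e) → Fin M) → (Fin p → Fin M) → Fin M
      out one      σ ρ = σ 0F
      out (var⁺ i) σ ρ = if s i then ρ i else σ 0F
      out (var⁻ i) σ ρ = if s i then σ 0F else ρ i
      out (succ e) σ ρ = σ 0F
      out (e ⊗ f)  σ ρ = σ 0F
      out (e ⊕ f)  σ ρ = σ 0F

      equations : (e : Expr p) → (Fin (size e) → Fin M) → (Fin p → Fin M) → System M
      equations one      σ ρ = isOne (σ 0F) ∷ []
      equations (var⁺ _) σ ρ = isOne (σ 0F) ∷ []
      equations (var⁻ _) σ ρ = isOne (σ 0F) ∷ []
      equations (succ e) σ ρ = addOne (out e (σ ∘ suc) ρ) (σ 0F) ∷ equations e (σ ∘ suc) ρ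
      equations (e ⊗ f)  σ ρ =
        mul (out e (leftOf 1 σ) ρ) (out f (rightOf 1 σ) ρ) (σ 0F) ∷
        (equations e (leftOf 1 σ) ρ ++ equations f (rightOf 1 σ) ρ)
      equations (e ⊕ f)  σ ρ =
        addition (σ ∘ (_↑ˡ (size e + size f))) (out e (leftOf 10 σ) ρ) (out f (rightOf 10 σ) ρ) ++
        (equations e (leftOf 10 σ) ρ ++ equations f (rightOf 10 σ) ρ)

      module Solutions (x : Vec ℕ M) (y : Vec ℕ p) where

        out-value : (e : Expr p) (σ : Fin (size e) → Fin M) (ρ : Fin p → Fin M) →
                    lookup x ∘ ρ ≗ lookup y → lookup x ∘ σ ≗ witness e y → lookup x (out e σ ρ) ≡ ⟦ e ⟧ y
        out-value one      σ ρ xρ xσ = xσ 0F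
        out-value (var⁺ i) σ ρ xρ xσ with s i
        ... | true  = xρ i
        ... | false = xσ 0F
        out-value (var⁻ i) σ ρ xρ xσ with s i
        ... | true  = xσ 0F
        ... | false = xρ i
        out-value (succ e) σ ρ xρ xσ = xσ 0F
        out-value (e ⊗ f)  σ ρ xρ xσ = xσ 0F
        out-value (e ⊕ f)  σ ρ xρ xσ = xσ 0F

        equations-sound : (e : Expr p) (σ : Fin (size e) → Fin M) (ρ : Fin p → Fin M) →
                          lookup x ∘ ρ ≗ lookup y → lookup x ∘ σ ≗ witness e y →
                          All (SatisfiesEqn x) (equations e σ ρ)
        equations-sound one      σ ρ xρ xσ = mul-holds (xσ 0F) (xσ 0F) (xσ 0F) ∷ []
        equations-sound (var⁺ _) σ ρ xρ xσ = mul-holds (xσ 0F) (xσ 0F) (xσ 0F) ∷ []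
        equations-sound (var⁻ _) σ ρ xρ xσ = mul-holds (xσ 0F) (xσ 0F) (xσ 0F) ∷ []
        equations-sound (succ e) σ ρ xρ xσ =
          addOne-holds (out-value e (σ ∘ suc) ρ xρ (xσ ∘ suc)) (xσ 0F) ∷
          equations-sound e (σ ∘ suc) ρ xρ (xσ ∘ suc)
        equations-sound (e ⊗ f)  σ ρ xρ xσ =
          mul-holds (out-value e σ₁ ρ xρ xσ₁) (out-value f σ₂ ρ xρ xσ₂) (xσ 0F) ∷
          ++⁺ (equations-sound e σ₁ ρ xρ xσ₁) (equations-sound f σ₂ ρ xρ xσ₂)
          where
          σ₁ : Fin (size e) → Fin M
          σ₁ = leftOf 1 σ
          σ₂ : Fin (size f) → Fin M
          σ₂ = rightOf 1 σ
          xσ₁ : lookup x ∘ σ₁ ≗ witness e y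
          xσ₁ = ≗-++⁻ˡ (xσ ∘ suc)
          xσ₂ : lookup x ∘ σ₂ ≗ witness f y
          xσ₂ = ≗-++⁻ʳ (xσ ∘ suc)
        equations-sound (e ⊕ f)  σ ρ xρ xσ =
          ++⁺ (addition-sound τ (≗-++⁻ˡ {m = 10} xσ) (out-value e σ₁ ρ xρ xσ₁) (out-value f σ₂ ρ xρ xσ₂))
              (++⁺ (equations-sound e σ₁ ρ xρ xσ₁) (equations-sound f σ₂ ρ xρ xσ₂))
          where
          τ : Fin 10 → Fin M
          τ = σ ∘ (_↑ˡ (size e + size f))
          σ₁ : Fin (size e) → Fin M
          σ₁ = leftOf 10 σ
          σ₂ : Fin (size f) → Fin M
          σ₂ = rightOf 10 σ
          xσ₁ : lookup x ∘ σ₁ ≗ witness e y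
          xσ₁ = ≗-++⁻ˡ (≗-++⁻ʳ {m = 10} xσ)
          xσ₂ : lookup x ∘ σ₂ ≗ witness f y
          xσ₂ = ≗-++⁻ʳ (≗-++⁻ʳ {m = 10} xσ)

        equations-complete : (e : Expr p) (σ : Fin (size e) → Fin M) (ρ : Fin p → Fin M) →
                             Positive x → lookup x ∘ ρ ≗ lookup y →
                             All (SatisfiesEqn x) (equations e σ ρ) → lookup x ∘ σ ≗ witness e y
        equations-complete one      σ ρ x>0 xρ (q ∷ []) 0F = n*n≡n⇒n≡1 _ (x>0 _) q
        equations-complete (var⁺ _) σ ρ x>0 xρ (q ∷ []) 0F = n*n≡n⇒n≡1 _ (x>0 _) q
        equations-complete (var⁻ _) σ ρ x>0 xρ (q ∷ []) 0F = n*n≡n⇒n≡1 _ (x>0 _) q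
        equations-complete (succ e) σ ρ x>0 xρ (q ∷ qs) = λ where
            zero    → trans (sym q) (cong (_+ 1) (out-value e (σ ∘ suc) ρ xρ xσ′))
            (suc j) → xσ′ j
          where
          xσ′ : lookup x ∘ σ ∘ suc ≗ witness e y
          xσ′ = equations-complete e (σ ∘ suc) ρ x>0 xρ qs
        equations-complete (e ⊗ f)  σ ρ x>0 xρ (q ∷ qs) = λ where
            zero    → trans (sym q) (cong₂ _*_ (out-value e σ₁ ρ xρ xσ₁) (out-value f σ₂ ρ xρ xσ₂))
            (suc j) → ≗-++⁺ xσ₁ xσ₂ j
          where
          σ₁ : Fin (size e) → Fin M
          σ₁ = leftOf 1 σ
          σ₂ : Fin (size f) → Fin M
          σ₂ = rightOf 1 σ
          xσ₁ : lookup x ∘ σ₁ ≗ witness e y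
          xσ₁ = equations-complete e σ₁ ρ x>0 xρ (++⁻ˡ (equations e σ₁ ρ) qs)
          xσ₂ : lookup x ∘ σ₂ ≗ witness f y
          xσ₂ = equations-complete f σ₂ ρ x>0 xρ (++⁻ʳ (equations e σ₁ ρ) qs)
        equations-complete (e ⊕ f)  σ ρ x>0 xρ qs =
          ≗-++⁺ (addition-complete τ (x>0 _) (out-value e σ₁ ρ xρ xσ₁) (out-value f σ₂ ρ xρ xσ₂)
                                   (++⁻ˡ (addition τ _ _) qs))
                (≗-++⁺ xσ₁ xσ₂)
          where
          τ : Fin 10 → Fin M
          τ = σ ∘ (_↑ˡ (size e + size f))
          σ₁ : Fin (size e) → Fin M
          σ₁ = leftOf 10 σ
          σ₂ : Fin (size f) → Fin M
          σ₂ = rightOf 10 σ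
          qs′ : All (SatisfiesEqn x) (equations e σ₁ ρ ++ equations f σ₂ ρ)
          qs′ = ++⁻ʳ (addition τ (out e σ₁ ρ) (out f σ₂ ρ)) qs
          xσ₁ : lookup x ∘ σ₁ ≗ witness e y
          xσ₁ = equations-complete e σ₁ ρ x>0 xρ (++⁻ˡ (equations e σ₁ ρ) qs′)
          xσ₂ : lookup x ∘ σ₂ ≗ witness f y
          xσ₂ = equations-complete f σ₂ ρ x>0 xρ (++⁻ʳ (equations e σ₁ ρ) qs′)

    module _ {y : Vec ℕ p} (y>0 : Positive y) where

      ⟦⟧-pos : (e : Expr p) → 1 ≤ ⟦ e ⟧ y
      ⟦⟧-pos one = s≤s z≤n
      ⟦⟧-pos (var⁺ i) with s i
      ... | true  = y>0 i
      ... | false = s≤s z≤n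
      ⟦⟧-pos (var⁻ i) with s i
      ... | true  = s≤s z≤n
      ... | false = y>0 i
      ⟦⟧-pos (succ e) = m≤n+m 1 (⟦ e ⟧ y)
      ⟦⟧-pos (e ⊗ f)  = *-mono-≤ (⟦⟧-pos e) (⟦⟧-pos f)
      ⟦⟧-pos (e ⊕ f)  = ≤-trans (⟦⟧-pos e) (m≤m+n _ _)

      witness-pos : (e : Expr p) → Vector.All (1 ≤_) (witness e y)
      witness-pos one      _ = s≤s z≤n
      witness-pos (var⁺ _) _ = s≤s z≤n
      witness-pos (var⁻ _) _ = s≤s z≤n
      witness-pos (succ e) = λ where
        zero    → m≤n+m 1 (⟦ e ⟧ y)
        (suc j) → witness-pos e j
      witness-pos (e ⊗ f) = λ where
        zero    → ⟦⟧-pos (e ⊗ f)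
        (suc j) → Vector.++⁺ (1 ≤_) (witness-pos e) (witness-pos f) j
      witness-pos (e ⊕ f) =
        Vector.++⁺ (1 ≤_) (additionTable-pos (⟦⟧-pos (e ⊕ f)) (⟦⟧-pos e) (⟦⟧-pos f))
                          (Vector.++⁺ (1 ≤_) (witness-pos e) (witness-pos f))

  -- Integer polynomials as differences of expressions

  Diff : ℕ → Set
  Diff p = Expr p × Expr p

  module _ {p : ℕ} where

    _+ᵈ_ _*ᵈ_ : Diff p → Diff p → Diff p
    (a , b) +ᵈ (c , d) = (a ⊕ c , b ⊕ d)
    (a , b) *ᵈ (c , d) = ((a ⊗ c) ⊕ (b ⊗ d) , (a ⊗ d) ⊕ (b ⊗ c))

    numeral : ℕ → Expr p
    numeral zero    = one
    numeral (suc n) = succ (numeral n)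

    constᵈ : ℤ → Diff p
    constᵈ (+ n)    = (numeral n , one)
    constᵈ -[1+ n ] = (one , numeral (suc n))

    _^ᵈ_ : Diff p → ℕ → Diff p
    u ^ᵈ zero  = constᵈ (+ 1)
    u ^ᵈ suc n = u *ᵈ (u ^ᵈ n)

    varᵈ : Fin p → Diff p
    varᵈ i = (var⁺ i , var⁻ i)

    monomialᵈ : ∀ {q} → Vec (Diff p) q → Vec ℕ q → Diff p
    monomialᵈ []       []       = constᵈ (+ 1)
    monomialᵈ (u ∷ us) (k ∷ ks) = (u ^ᵈ k) *ᵈ monomialᵈ us ks

    polyᵈ : ∀ {q} → Vec (Diff p) q → Poly q → Diff p
    polyᵈ us []             = constᵈ (+ 0)
    polyᵈ us ((c , ks) ∷ D) = (constᵈ c *ᵈ monomialᵈ us ks) +ᵈ polyᵈ us D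

  signs : ∀ {p} → Vec ℤ p → Fin p → Bool
  signs X i = 0ℤ ℤ.≤ᵇ lookup X i

  magnitudes : ∀ {p} → Vec ℤ p → Vec ℕ p
  magnitudes = map (suc ∘ ∣_∣)

  module DiffSemantics {p : ℕ} (s : Fin p → Bool) (y : Vec ℕ p) where
    open Semantics s

    ⟦_⟧ᵈ : Diff p → ℤ
    ⟦ a , b ⟧ᵈ = + ⟦ a ⟧ y ℤ.- + ⟦ b ⟧ y

    ⟦+ᵈ⟧ : ∀ u v → ⟦ u +ᵈ v ⟧ᵈ ≡ ⟦ u ⟧ᵈ ℤ.+ ⟦ v ⟧ᵈ
    ⟦+ᵈ⟧ (a , b) (c , d) =
      trans (cong₂ ℤ._-_ (ℤ.pos-+ (⟦ a ⟧ y) (⟦ c ⟧ y)) (ℤ.pos-+ (⟦ b ⟧ y) (⟦ d ⟧ y)))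
            (regroup (+ ⟦ a ⟧ y) (+ ⟦ b ⟧ y) (+ ⟦ c ⟧ y) (+ ⟦ d ⟧ y))
      where
      regroup : ∀ a b c d → (a ℤ.+ c) ℤ.- (b ℤ.+ d) ≡ (a ℤ.- b) ℤ.+ (c ℤ.- d)
      regroup = ℤ-Solver.solve-∀

    ⟦*ᵈ⟧ : ∀ u v → ⟦ u *ᵈ v ⟧ᵈ ≡ ⟦ u ⟧ᵈ ℤ.* ⟦ v ⟧ᵈ
    ⟦*ᵈ⟧ (a , b) (c , d) =
      trans (cong₂ ℤ._-_ (pos-+* (⟦ a ⟧ y) (⟦ c ⟧ y) (⟦ b ⟧ y) (⟦ d ⟧ y))
                         (pos-+* (⟦ a ⟧ y) (⟦ d ⟧ y) (⟦ b ⟧ y) (⟦ c ⟧ y)))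
            (factor (+ ⟦ a ⟧ y) (+ ⟦ b ⟧ y) (+ ⟦ c ⟧ y) (+ ⟦ d ⟧ y))
      where
      pos-+* : ∀ m n k l → + (m * n + k * l) ≡ + m ℤ.* + n ℤ.+ + k ℤ.* + l
      pos-+* m n k l = trans (ℤ.pos-+ (m * n) (k * l)) (cong₂ ℤ._+_ (ℤ.pos-* m n) (ℤ.pos-* k l))
      factor : ∀ a b c d → (a ℤ.* c ℤ.+ b ℤ.* d) ℤ.- (a ℤ.* d ℤ.+ b ℤ.* c) ≡ (a ℤ.- b) ℤ.* (c ℤ.- d)
      factor = ℤ-Solver.solve-∀

    ⟦numeral⟧ : ∀ n → ⟦ numeral n ⟧ y ≡ suc n
    ⟦numeral⟧ zero    = refl
    ⟦numeral⟧ (suc n) = trans (cong (_+ 1) (⟦numeral⟧ n)) (+-comm (suc n) 1)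

    ⟦constᵈ⟧ : ∀ c → ⟦ constᵈ c ⟧ᵈ ≡ c
    ⟦constᵈ⟧ (+ n)    rewrite ⟦numeral⟧ n       = refl
    ⟦constᵈ⟧ -[1+ n ] rewrite ⟦numeral⟧ (suc n) = refl

    ⟦^ᵈ⟧ : ∀ u n → ⟦ u ^ᵈ n ⟧ᵈ ≡ ⟦ u ⟧ᵈ ℤ.^ n
    ⟦^ᵈ⟧ u zero    = ⟦constᵈ⟧ (+ 1)
    ⟦^ᵈ⟧ u (suc n) = trans (⟦*ᵈ⟧ u (u ^ᵈ n)) (cong (⟦ u ⟧ᵈ ℤ.*_) (⟦^ᵈ⟧ u n))

    ⟦monomialᵈ⟧ : ∀ {q} (us : Vec (Diff p) q) ks → ⟦ monomialᵈ us ks ⟧ᵈ ≡ monomialValue (map ⟦_⟧ᵈ us) ks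
    ⟦monomialᵈ⟧ []       []       = ⟦constᵈ⟧ (+ 1)
    ⟦monomialᵈ⟧ (u ∷ us) (k ∷ ks) =
      trans (⟦*ᵈ⟧ (u ^ᵈ k) (monomialᵈ us ks)) (cong₂ ℤ._*_ (⟦^ᵈ⟧ u k) (⟦monomialᵈ⟧ us ks))

    ⟦polyᵈ⟧ : ∀ {q} (us : Vec (Diff p) q) D → ⟦ polyᵈ us D ⟧ᵈ ≡ eval D (map ⟦_⟧ᵈ us)
    ⟦polyᵈ⟧ us []             = ⟦constᵈ⟧ (+ 0)
    ⟦polyᵈ⟧ us ((c , ks) ∷ D) =
      trans (⟦+ᵈ⟧ (constᵈ c *ᵈ monomialᵈ us ks) (polyᵈ us D))
            (cong₂ ℤ._+_ (trans (⟦*ᵈ⟧ (constᵈ c) (monomialᵈ us ks)) (cong₂ ℤ._*_ (⟦constᵈ⟧ c) (⟦monomialᵈ⟧ us ks)))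
                         (⟦polyᵈ⟧ us D))

    ⟦⟧ᵈ≡0⇒≡ : ∀ a b → ⟦ a , b ⟧ᵈ ≡ 0ℤ → ⟦ a ⟧ y ≡ ⟦ b ⟧ y
    ⟦⟧ᵈ≡0⇒≡ a b eq = ℤ.+-injective (ℤ.i-j≡0⇒i≡j _ _ eq)

    ≡⇒⟦⟧ᵈ≡0 : ∀ a b → ⟦ a ⟧ y ≡ ⟦ b ⟧ y → ⟦ a , b ⟧ᵈ ≡ 0ℤ
    ≡⇒⟦⟧ᵈ≡0 a b eq = ℤ.i≡j⇒i-j≡0 (cong +_ eq)

    decode : Vec ℤ p
    decode = tabulate (⟦_⟧ᵈ ∘ varᵈ)

    ⟦polyᵈ-varᵈ⟧ : ∀ D → ⟦ polyᵈ (tabulate varᵈ) D ⟧ᵈ ≡ eval D decode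
    ⟦polyᵈ-varᵈ⟧ D = trans (⟦polyᵈ⟧ (tabulate varᵈ) D) (cong (eval D) (sym (tabulate-∘ ⟦_⟧ᵈ varᵈ)))

    suc∣⟦varᵈ⟧ᵈ∣ : ∀ i → 1 ≤ lookup y i → suc ∣ ⟦ varᵈ i ⟧ᵈ ∣ ≡ lookup y i
    suc∣⟦varᵈ⟧ᵈ∣ i 1≤yᵢ with s i | lookup y i | 1≤yᵢ
    ... | true  | suc _       | _ = refl
    ... | false | suc zero    | _ = refl
    ... | false | suc (suc _) | _ = refl

    ⟦varᵈ⟧ : ∀ i x → s i ≡ (0ℤ ℤ.≤ᵇ x) → lookup y i ≡ suc ∣ x ∣ → ⟦ varᵈ i ⟧ᵈ ≡ x
    ⟦varᵈ⟧ i (+ _)      sᵢ yᵢ rewrite sᵢ | yᵢ = refl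
    ⟦varᵈ⟧ i -[1+ _ ] sᵢ yᵢ rewrite sᵢ | yᵢ = refl

    magnitudes-decode : Positive y → magnitudes decode ≡ y
    magnitudes-decode y>0 = begin
      map (suc ∘ ∣_∣) (tabulate (⟦_⟧ᵈ ∘ varᵈ))  ≡⟨ tabulate-∘ (suc ∘ ∣_∣) _ ⟨
      tabulate (λ i → suc ∣ ⟦ varᵈ i ⟧ᵈ ∣)      ≡⟨ tabulate-cong (λ i → suc∣⟦varᵈ⟧ᵈ∣ i (y>0 i)) ⟩
      tabulate (lookup y)                       ≡⟨ tabulate∘lookup y ⟩
      y                                         ∎
      where open ≡-Reasoning

  module _ {p : ℕ} (X : Vec ℤ p) where
    open DiffSemantics (signs X) (magnitudes X)

    decode-magnitudes : decode ≡ X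
    decode-magnitudes = trans (tabulate-cong (λ i → ⟦varᵈ⟧ i (lookup X i) refl (lookup-map i _ X))) (tabulate∘lookup X)

  -- The system attached to a polynomial and a sign pattern

  module Encoding {p : ℕ} (D : Poly p) where

    P Q : Expr p
    P = proj₁ (polyᵈ (tabulate varᵈ) D)
    Q = proj₂ (polyᵈ (tabulate varᵈ) D)

    N : ℕ
    N = suc ((size P + size Q) + p)

    σP : Fin (size P) → Fin N
    σP = suc ∘ (_↑ˡ p) ∘ (_↑ˡ size Q)

    σQ : Fin (size Q) → Fin N
    σQ = suc ∘ (_↑ˡ p) ∘ (size P ↑ʳ_)

    ρ : Fin p → Fin N
    ρ = suc ∘ ((size P + size Q) ↑ʳ_)

    module _ (s : Fin p → Bool) where
      open Semantics s

      -- P = Q is expressed by making the unknown 0 equal to both P + 1 and Q + 1.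
      system : System N
      system = addOne (out P σP ρ) 0F ∷ addOne (out Q σQ ρ) 0F ∷ (equations P σP ρ ++ equations Q σQ ρ)

      canonical : Vec ℕ p → Vector ℕ N
      canonical y = (⟦ P ⟧ y + 1) Vector.∷ ((witness P y Vector.++ witness Q y) Vector.++ lookup y)

      canonical-pos : ∀ {y} → Positive y → Vector.All (1 ≤_) (canonical y)
      canonical-pos {y} y>0 zero    = m≤n+m 1 (⟦ P ⟧ y)
      canonical-pos {y} y>0 (suc k) =
        Vector.++⁺ (1 ≤_) (Vector.++⁺ (1 ≤_) (witness-pos y>0 P) (witness-pos y>0 Q)) y>0 k

      system-sound : ∀ {x y} → ⟦ P ⟧ y ≡ ⟦ Q ⟧ y → lookup x ≗ canonical y → All (SatisfiesEqn x) system
      system-sound {x} {y} P≡Q x≗ =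
        addOne-holds (out-value P σP ρ xρ xP) (x≗ 0F) ∷
        addOne-holds (out-value Q σQ ρ xρ xQ) (trans (x≗ 0F) (cong (_+ 1) P≡Q)) ∷
        ++⁺ (equations-sound P σP ρ xρ xP) (equations-sound Q σQ ρ xρ xQ)
        where
        open Solutions x y
        xρ : lookup x ∘ ρ ≗ lookup y
        xρ = ≗-++⁻ʳ (x≗ ∘ suc)
        xP : lookup x ∘ σP ≗ witness P y
        xP = ≗-++⁻ˡ (≗-++⁻ˡ (x≗ ∘ suc))
        xQ : lookup x ∘ σQ ≗ witness Q y
        xQ = ≗-++⁻ʳ (≗-++⁻ˡ (x≗ ∘ suc))

      canonical-solution : ∀ {y} → Positive y → ⟦ P ⟧ y ≡ ⟦ Q ⟧ y → PosSolution system (tabulate (canonical y))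
      canonical-solution {y} y>0 P≡Q =
        (λ k → subst (1 ≤_) (sym (lookup∘tabulate (canonical y) k)) (canonical-pos y>0 k)) ,
        system-sound P≡Q (lookup∘tabulate (canonical y))

      system-complete : ∀ {x y} → PosSolution system x → lookup x ∘ ρ ≗ lookup y →
                        x ≡ tabulate (canonical y) × ⟦ P ⟧ y ≡ ⟦ Q ⟧ y
      system-complete {x} {y} (x>0 , qP ∷ qQ ∷ qs) xρ =
        trans (sym (tabulate∘lookup x)) (tabulate-cong x≗) , +-cancelʳ-≡ 1 _ _ (trans (sym x₀≡P+1) x₀≡Q+1)
        where
        open Solutions x y
        xP : lookup x ∘ σP ≗ witness P y
        xP = equations-complete P σP ρ x>0 xρ (++⁻ˡ (equations P σP ρ) qs)
        xQ : lookup x ∘ σQ ≗ witness Q y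
        xQ = equations-complete Q σQ ρ x>0 xρ (++⁻ʳ (equations P σP ρ) qs)
        x₀≡P+1 : lookup x 0F ≡ ⟦ P ⟧ y + 1
        x₀≡P+1 = trans (sym qP) (cong (_+ 1) (out-value P σP ρ xρ xP))
        x₀≡Q+1 : lookup x 0F ≡ ⟦ Q ⟧ y + 1
        x₀≡Q+1 = trans (sym qQ) (cong (_+ 1) (out-value Q σQ ρ xρ xQ))
        x≗ : lookup x ≗ canonical y
        x≗ zero    = x₀≡P+1
        x≗ (suc k) = ≗-++⁺ (≗-++⁺ xP xQ) xρ k

    encode : (Fin p → Bool) → Vec ℤ p → Vec ℕ N
    encode s X = tabulate (canonical s (magnitudes X))

    encode-solution : ∀ X → IntSolution D X → PosSolution (system (signs X)) (encode (signs X) X)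
    encode-solution X D[X]≡0 = canonical-solution (signs X) y>0 (⟦⟧ᵈ≡0⇒≡ P Q (begin
      ⟦ polyᵈ (tabulate varᵈ) D ⟧ᵈ  ≡⟨ ⟦polyᵈ-varᵈ⟧ D ⟩
      eval D decode                 ≡⟨ cong (eval D) (decode-magnitudes X) ⟩
      eval D X                      ≡⟨ D[X]≡0 ⟩
      0ℤ                            ∎))
      where
      y : Vec ℕ p
      y = magnitudes X
      open DiffSemantics (signs X) y
      open ≡-Reasoning
      y>0 : Positive y
      y>0 i = subst (1 ≤_) (sym (lookup-map i _ X)) (s≤s z≤n)

    lookup-encode-ρ : ∀ s X i → lookup (encode s X) (ρ i) ≡ suc ∣ lookup X i ∣
    lookup-encode-ρ s X i = begin
      lookup (encode s X) (ρ i)  ≡⟨ lookup∘tabulate (canonical s y) (ρ i) ⟩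
      canonical s y (ρ i)        ≡⟨ lookup-++ʳ (witness P y Vector.++ witness Q y) (lookup y) i ⟩
      lookup y i                 ≡⟨ lookup-map i _ X ⟩
      suc ∣ lookup X i ∣         ∎
      where
      y : Vec ℕ p
      y = magnitudes X
      open Semantics s
      open ≡-Reasoning

    encode-finitelyMany : FinitelyManyIntSolutions D → ∀ s → FinitelyManyPosSolutions (system s)
    encode-finitelyMany (Xs , Xs-complete) s = List.map (encode s) Xs , encoded
      where
      encoded : ∀ x → PosSolution (system s) x → x ∈ List.map (encode s) Xs
      encoded x x-solution = subst (_∈ List.map (encode s) Xs) (sym x≡encode) (∈-map⁺ (encode s) decode∈Xs)
        where
        y : Vec ℕ p
        y = tabulate (lookup x ∘ ρ)
        xρ : lookup x ∘ ρ ≗ lookup y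
        xρ i = sym (lookup∘tabulate (lookup x ∘ ρ) i)
        y>0 : Positive y
        y>0 i = subst (1 ≤_) (xρ i) (proj₁ x-solution (ρ i))
        open Semantics s
        open DiffSemantics s y
        x≡canonical : x ≡ tabulate (canonical s y) × ⟦ P ⟧ y ≡ ⟦ Q ⟧ y
        x≡canonical = system-complete s x-solution xρ
        decode∈Xs : decode ∈ Xs
        decode∈Xs = Xs-complete decode (trans (sym (⟦polyᵈ-varᵈ⟧ D)) (≡⇒⟦⟧ᵈ≡0 P Q (proj₂ x≡canonical)))
        x≡encode : x ≡ encode s decode
        x≡encode = trans (proj₁ x≡canonical) (cong (tabulate ∘ canonical s) (sym (magnitudes-decode y>0)))

open Reduction

open import Data.Nat using (ℕ; suc; s≤s; z≤n)
open import Data.Nat.Properties using (n≤1+n; module ≤-Reasoning)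
open import Data.Integer using (ℤ; ∣_∣; _≤_; +_; +≤+)
open import Data.Fin using (Fin)
open import Data.Vec using (Vec; lookup)
open import Data.Product using (Σ; _,_)

corollary2 : Conjecture →
    Σ ((p : ℕ) → Poly p → ℤ) (λ B →
      (p : ℕ) (D : Poly p) → FinitelyManyIntSolutions D →
      (x : Vec ℤ p) → IntSolution D x → (i : Fin p) → + ∣ lookup x i ∣ ≤ B p D)
corollary2 conjecture = (λ p D → + f (Encoding.N D)) , bound
  where
  bound : (p : ℕ) (D : Poly p) → FinitelyManyIntSolutions D →
          (x : Vec ℤ p) → IntSolution D x → (i : Fin p) → + ∣ lookup x i ∣ ≤ + f (Encoding.N D)
  bound p D finite X D[X]≡0 i = +≤+ (begin
    ∣ lookup X i ∣                                  ≤⟨ n≤1+n _ ⟩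
    suc ∣ lookup X i ∣                              ≡⟨ lookup-encode-ρ (signs X) X i ⟨
    lookup (encode (signs X) X) (ρ i)               ≤⟨ conjecture N (s≤s z≤n) (system (signs X))
                                                         (encode-finitelyMany finite (signs X))
                                                         (encode (signs X) X) (encode-solution X D[X]≡0) (ρ i) ⟩
    f N                                             ∎)
    where
    open Encoding D
    open ≤-Reasoning
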